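{- Let $m\ge1$, $n\ge0$, let $y_1,\dots,y_m$ be distinct integers less than $-1$, let $x_1,\dots,x_n$ be distinct integers greater than $1$, and let $D=\{1,y_1,\dots,y_m,x_1,\dots,x_n\}$. Then $diam(D)=diam(D\cup\{0\})$, and $diam(D)=4$ if $m=1$, $diam(D)=5$ if $m=2$, and $diam(D)=6$ if $m>2$.
   Context: A signed tree is a pair $(T,s)$ with $T$ a finite tree and $s:E(T)\to\{+,-\}$. The signed degree $sdeg(v)$ of a vertex is the number of incident positive edges minus the number of incident negative edges. $(T,s)$ realizes $D$ if $D=\{sdeg(v):v\in V(T)\}$. For a set $D$ of integers containing $1$ or $-1$, $diam(D)$ is the minimum of $diam(T)$ over all signed trees $(T,s)$ that realize $D$. -}

module Defs where

open import Data.Nat using (ℕ; zero; suc; _≤_; _<_)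
open import Data.Integer as ℤ using (ℤ; +_; -[1+_])
open import Data.Fin using (Fin)
open import Data.Bool using (Bool; true; false; if_then_else_)
open import Data.List using (List; []; _∷_; _++_; [_]; length; map; foldr; allFin)
open import Data.List.Relation.Unary.Unique.Propositional using (Unique)
open import Data.Product using (Σ; ∃; ∃-syntax; _×_; _,_)
open import Data.Sum using (_⊎_)
open import Data.Unit using (⊤)
open import Relation.Nullary using (¬_)
open import Relation.Binary.PropositionalEquality using (_≡_)
open import Function.Bundles using (_⇔_)

data Sign : Set where
  plus minus : Sign

signValue : Sign → ℤ
signValue plus  = + 1
signValue minus = -[1+ 0 ]

record SignedGraph : Set where
  field
    N      : ℕ
    adj    : Fin N → Fin N → Bool
    adjSym : ∀ u v → adj u v ≡ adj v u
    adjIrr : ∀ v → adj v v ≡ false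
    sign   : Fin N → Fin N → Sign
    signSym : ∀ u v → sign u v ≡ sign v u

module _ (G : SignedGraph) where
  open SignedGraph G

  data Walk : Fin N → Fin N → ℕ → Set where
    here : ∀ {v} → Walk v v 0
    step : ∀ {u w v k} → adj u w ≡ true → Walk w v k → Walk u v (suc k)

  IsWalkList : List (Fin N) → Set
  IsWalkList []            = ⊤
  IsWalkList (x ∷ [])      = ⊤
  IsWalkList (x ∷ y ∷ r)   = (adj x y ≡ true) × IsWalkList (y ∷ r)

  Cycle : Set
  Cycle = Σ (Fin N) λ v → Σ (List (Fin N)) λ vs →
            (2 ≤ length vs) × Unique (v ∷ vs) × IsWalkList (v ∷ (vs ++ [ v ]))

  Connected : Set
  Connected = ∀ u v → ∃[ k ] Walk u v k

  IsTree : Set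
  IsTree = (1 ≤ N) × Connected × ¬ Cycle

  sdeg : Fin N → ℤ
  sdeg v = foldr ℤ._+_ (+ 0) (map (λ u → if adj v u then signValue (sign v u) else + 0) (allFin N))

  Dist : Fin N → Fin N → ℕ → Set
  Dist u v d = Walk u v d × (∀ k → Walk u v k → d ≤ k)

  Diam : ℕ → Set
  Diam d = (∃[ u ] ∃[ v ] Dist u v d) × (∀ u v e → Dist u v e → e ≤ d)

  Realizes : (ℤ → Set) → Set
  Realizes D = ∀ z → D z ⇔ (∃[ v ] sdeg v ≡ z)

DiamSet : (ℤ → Set) → ℕ → Set
DiamSet D d =
  (Σ SignedGraph λ T → IsTree T × Realizes T D × Diam T d) ×
  (∀ (T : SignedGraph) e → IsTree T → Realizes T D → Diam T e → d ≤ e)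

DSet : ∀ {m n} → (Fin m → ℤ) → (Fin n → ℤ) → ℤ → Set
DSet y x z = (z ≡ + 1) ⊎ (∃[ i ] y i ≡ z) ⊎ (∃[ j ] x j ≡ z)

_∪0 : (ℤ → Set) → ℤ → Set
(D ∪0) z = D z ⊎ (z ≡ + 0)

predicted : ℕ → ℕ
predicted 1 = 4
predicted 2 = 5
predicted _ = 6

{-# OPTIONS --safe #-}
module Submission where

-- In a tree realizing D, a vertex of signed degree y < -1 has at least two negative
-- edges, and since -1 ∉ D none of them ends in a leaf; so a non-backtracking walk ending at such a
-- vertex extends by two more edges, whichever edge it arrived by. In a tree, non-backtracking
-- walks are shortest paths. One such vertex gives a path of length 4; two give the path between
-- them (length ≥ 1) extended to ≥ 5; of three, either two are at distance ≥ 2, or they form a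
-- path c ~ a ~ b, and extending gives ≥ 6.
--
-- A star with j leaves hung by an edge of sign s has value (signed degree) s + j at its
-- centre. A vertex gets the value y_i from stars of value 1 hung by negative edges (one of them
-- replaced by a star of an extra value c ≥ 0), and the values x_j come from stars hung by
-- positive edges, balanced by as many negative stars of value 1. For m = 1 this tree has depth
-- 2; for m = 2 two such vertices are joined by a negative edge; for m ≥ 3 they hang by negative
-- edges below a centre of value 1. The diameters are 4, 5 and 6, and c = 1 realizes D while
-- c = 0 realizes D ∪ {0}.

import Data.Integer.Properties as ℤP
open import Defs
open import Algebra.Properties.CommutativeMonoid.Sum ℤP.+-0-commutativeMonoid
  using (sum; sum-cong-≗; sum-remove; sum-replicate-zero)
open import Data.Bool using (Bool; true; false; if_then_else_; _∧_)
open import Data.Bool.Properties using (∧-comm) renaming (_≟_ to _≟ᵇ_)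
open import Data.Empty using (⊥; ⊥-elim)
open import Data.Fin using (Fin; zero; suc; _↑ˡ_; _↑ʳ_; splitAt; join)
open import Data.Fin.Properties
  using (any?; punchInᵢ≢i; splitAt-↑ˡ; splitAt-↑ʳ; splitAt⁻¹-↑ˡ; splitAt⁻¹-↑ʳ; join-splitAt)
  renaming (_≟_ to _≟ᶠ_)
open import Data.Integer as ℤ using (ℤ; +_; -[1+_])
open import Data.Integer.Tactic.RingSolver using (solve-∀)
open import Data.List using (List; []; _∷_; _++_; [_]; foldr; tabulate)
open import Data.List.Properties using (∷-injectiveˡ; ∷-injectiveʳ; map-tabulate)
open import Data.List.Membership.Propositional using (_∈_)
open import Data.List.Membership.Propositional.Properties using (∈-∃++)
open import Data.List.Relation.Unary.All as All using (All; []; _∷_)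
open import Data.List.Relation.Unary.All.Properties using (¬Any⇒All¬; All¬⇒¬Any; ++⁻ˡ; ++⁻ʳ)
open import Data.List.Relation.Unary.AllPairs using ([]; _∷_)
open import Data.List.Relation.Unary.Any as Any using ()
open import Data.List.Relation.Unary.Unique.Propositional using (Unique)
open import Data.Nat using (ℕ; zero; suc; _+_; _∸_; _≤_; _<_; z≤n; s≤s)
open import Data.Nat.Induction using (<-rec)
open import Data.Nat.Properties as ℕP
  using (≤-refl; ≤-trans; ≤-antisym; ≤-pred; n≤1+n; m≤m+n; ≮⇒≥; <-cmp; <-trans; <-asym; <-irrefl;
         suc-injective; 0≢1+n; +-suc; +-identityʳ; anyUpTo?)
open import Data.Product using (Σ; ∃; ∃₂; ∃-syntax; _×_; _,_; proj₁; proj₂; map₁; map₂)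
open import Data.Sum using (_⊎_; inj₁; inj₂)
open import Data.Unit using (⊤; tt)
open import Data.Vec.Functional using (removeAt)
open import Function using (_∘_; id)
open import Function.Bundles using (_⇔_; Equivalence; mk⇔)
open import Function.Definitions using (Injective)
open import Relation.Binary using (tri<; tri≈; tri>)
open import Relation.Binary.PropositionalEquality
  using (_≡_; _≢_; refl; sym; trans; cong; cong₂; subst; subst₂; module ≡-Reasoning)
open import Relation.Nullary using (¬_; Dec; yes; no)
open import Relation.Nullary.Decidable using (_×-dec_; ¬?)
open import Relation.Unary using (Pred; Decidable)

least : ∀ {p} {P : Pred ℕ p} → Decidable P → ∀ {k} → P k → Σ ℕ λ d → P d × (∀ j → P j → d ≤ j)
least {P = P} P? {k} = <-rec (λ k → P k → Σ ℕ λ d → P d × (∀ j → P j → d ≤ j)) go k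
  where
  go : ∀ k → (∀ {j} → j < k → P j → Σ ℕ λ d → P d × (∀ j → P j → d ≤ j)) →
       P k → Σ ℕ λ d → P d × (∀ j → P j → d ≤ j)
  go k smaller Pk with anyUpTo? P? k
  ... | yes (j , j<k , Pj) = smaller j<k Pj
  ... | no none = k , Pk , λ j Pj → ≮⇒≥ (λ j<k → none (j , j<k , Pj))

sum-++ : ∀ m k (f : Fin (m + k) → ℤ) → sum f ≡ sum (f ∘ (_↑ˡ k)) ℤ.+ sum (f ∘ (m ↑ʳ_))
sum-++ zero k f = sym (ℤP.+-identityˡ _)
sum-++ (suc m) k f = trans (cong (ℤ._+_ (f zero)) (sum-++ m k (f ∘ suc))) (sym (ℤP.+-assoc (f zero) _ _))

sum-nonneg : ∀ {n} {f : Fin n → ℤ} → (∀ i → + 0 ℤ.≤ f i) → + 0 ℤ.≤ sum f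
sum-nonneg {zero} _ = ℤ.+≤+ z≤n
sum-nonneg {suc n} f≥0 = ℤP.+-mono-≤ (f≥0 zero) (sum-nonneg (f≥0 ∘ suc))

sum-≥-1 : ∀ {n} {f : Fin n → ℤ} i → -[1+ 0 ] ℤ.≤ f i → (∀ j → j ≢ i → + 0 ℤ.≤ f j) → -[1+ 0 ] ℤ.≤ sum f
sum-≥-1 {suc n} {f} i fi≥-1 others≥0 = begin
  -[1+ 0 ]                      ≤⟨ ℤP.+-mono-≤ fi≥-1 (sum-nonneg λ j → others≥0 _ (punchInᵢ≢i i j)) ⟩
  f i ℤ.+ sum (removeAt f i)    ≡⟨ sum-remove f ⟨
  sum f                         ∎
  where open ℤP.≤-Reasoning

sum-single : ∀ {n} {f : Fin n → ℤ} i → (∀ j → j ≢ i → f j ≡ + 0) → sum f ≡ f i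
sum-single {suc n} {f} i others≡0 = begin
  sum f                       ≡⟨ sum-remove f ⟩
  f i ℤ.+ sum (removeAt f i)  ≡⟨ cong (ℤ._+_ (f i)) (sum-cong-≗ λ j → others≡0 _ (punchInᵢ≢i i j)) ⟩
  f i ℤ.+ sum {n} (λ _ → + 0) ≡⟨ cong (ℤ._+_ (f i)) (sum-replicate-zero n) ⟩
  f i ℤ.+ + 0                 ≡⟨ ℤP.+-identityʳ (f i) ⟩
  f i                         ∎
  where open ≡-Reasoning

foldr-tabulate : ∀ {n} (f : Fin n → ℤ) → foldr ℤ._+_ (+ 0) (tabulate f) ≡ sum f
foldr-tabulate {zero} f = refl
foldr-tabulate {suc n} f = cong (ℤ._+_ (f zero)) (foldr-tabulate (f ∘ suc))

Unique-++-∷⁻ : ∀ {a} {A : Set a} (xs : List A) {y ys} → Unique (xs ++ y ∷ ys) → All (y ≢_) xs × Unique xs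
Unique-++-∷⁻ [] _ = [] , []
Unique-++-∷⁻ (x ∷ xs) (x∉ ∷ unique) with Unique-++-∷⁻ xs unique
... | y∉xs , unique-xs = (λ y≡x → All.head (++⁻ʳ xs x∉) (sym y≡x)) ∷ y∉xs , ++⁻ˡ xs x∉ ∷ unique-xs

DistanceAtLeast : SignedGraph → ℕ → Set
DistanceAtLeast G ℓ = ∃[ u ] ∃[ v ] ∃[ d ] Dist G u v d × ℓ ≤ d

DistanceAtLeast-mono : ∀ {G ℓ ℓ′} → ℓ ≤ ℓ′ → DistanceAtLeast G ℓ′ → DistanceAtLeast G ℓ
DistanceAtLeast-mono ℓ≤ℓ′ (u , v , d , dist , ℓ′≤d) = u , v , d , dist , ≤-trans ℓ≤ℓ′ ℓ′≤d

Diam-≥ : ∀ {G e ℓ} → Diam G e → DistanceAtLeast G ℓ → ℓ ≤ e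
Diam-≥ (_ , distances≤e) (u , v , d , dist , ℓ≤d) = ≤-trans ℓ≤d (distances≤e u v d dist)

-- Non-backtracking walks

module _ (G : SignedGraph) where
  open SignedGraph G

  adj-sym : ∀ {u w} → adj u w ≡ true → adj w u ≡ true
  adj-sym {u} {w} a = trans (adjSym w u) a

  adj⇒≢ : ∀ {u w} → adj u w ≡ true → u ≢ w
  adj⇒≢ {u} a refl with trans (sym a) (adjIrr u)
  ... | ()

module _ {G : SignedGraph} where

  _++ʷ_ : ∀ {u v w k l} → Walk G u v k → Walk G v w l → Walk G u w (k + l)
  here ++ʷ q = q
  step a p ++ʷ q = step a (p ++ʷ q)

  private
    reverseOnto : ∀ {u v w k l} → Walk G u v k → Walk G u w l → Walk G v w (k + l)
    reverseOnto here acc = acc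
    reverseOnto {k = suc k} {l} (step a p) acc =
      subst (Walk G _ _) (+-suc k l) (reverseOnto p (step (adj-sym G a) acc))

  reverseʷ : ∀ {u v k} → Walk G u v k → Walk G v u k
  reverseʷ {k = k} p = subst (Walk G _ _) (+-identityʳ k) (reverseOnto p here)

module _ (G : SignedGraph) where
  open SignedGraph G
  open import Data.List.Membership.DecPropositional (_≟ᶠ_ {N}) using (_∈?_)

  walk? : ∀ k u v → Dec (Walk G u v k)
  walk? zero u v with u ≟ᶠ v
  ... | yes refl = yes here
  ... | no u≢v = no λ { here → u≢v refl }
  walk? (suc k) u v with any? (λ w → (adj u w ≟ᵇ true) ×-dec walk? k w v)
  ... | yes (w , a , p) = yes (step a p)
  ... | no none = no λ { (step a p) → none (_ , a , p) }

  walk⇒dist : ∀ {u v k} → Walk G u v k → ∃[ d ] Dist G u v d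
  walk⇒dist {u} {v} = least (λ k → walk? k u v)

  -- NBWalk p u v k : a walk of length k from u to v that never steps straight back to the
  -- vertex it has just left; p is the vertex from which u was entered.
  data NBWalk : Fin N → Fin N → Fin N → ℕ → Set where
    nil  : ∀ {p v} → NBWalk p v v 0
    cons : ∀ {p u w v k} → adj u w ≡ true → w ≢ p → NBWalk u w v k → NBWalk p u v (suc k)

  nbWalk⇒walk : ∀ {p u v k} → NBWalk p u v k → Walk G u v k
  nbWalk⇒walk nil = here
  nbWalk⇒walk (cons a _ P) = step a (nbWalk⇒walk P)

  vertices : ∀ {p u v k} → NBWalk p u v k → List (Fin N)
  vertices (nil {v = v}) = [ v ]
  vertices (cons {u = u} _ _ P) = u ∷ vertices P

  vertices-head : ∀ {p u v k} (P : NBWalk p u v k) → ∃ λ t → vertices P ≡ u ∷ t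
  vertices-head nil = _ , refl
  vertices-head (cons _ _ P) = _ , refl

  vertices-second : ∀ {p u v k} (P : NBWalk p u v k) t → vertices P ≢ u ∷ p ∷ t
  vertices-second nil t ()
  vertices-second (cons {w = w} _ w≢p P) t eq with vertices-head P
  ... | _ , eq′ = w≢p (∷-injectiveˡ (∷-injectiveʳ (trans (cong (_ ∷_) (sym eq′)) eq)))

  last∈vertices : ∀ {p u v k} (P : NBWalk p u v k) → v ∈ vertices P
  last∈vertices nil = Any.here refl
  last∈vertices (cons _ _ P) = Any.there (last∈vertices P)

  vertices-walk : ∀ {p u v k} (P : NBWalk p u v k) → IsWalkList G (vertices P)
  vertices-walk nil = tt
  vertices-walk (cons a _ P) with vertices-head P | vertices-walk P
  ... | _ , eq | walkP rewrite eq = a , walkP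

  next : ∀ {p u v k} → NBWalk p u v k → Fin N
  next (nil {v = v}) = v
  next (cons {w = w} _ _ _) = w

  reenter : ∀ {p q u v k} (P : NBWalk p u v k) → q ≢ next P → NBWalk q u v k
  reenter nil _ = nil
  reenter (cons a _ P) q≢w = cons a (λ w≡q → q≢w (sym w≡q)) P

  previous : ∀ {p u v k} → NBWalk p u v k → Fin N
  previous (nil {p = p}) = p
  previous (cons _ _ P) = previous P

  snoc : ∀ {p u v z k} (P : NBWalk p u v k) → adj v z ≡ true → z ≢ previous P → NBWalk p u z (suc k)
  snoc nil a z≢p = cons a z≢p nil
  snoc (cons a′ w≢p P) a z≢ = cons a′ w≢p (snoc P a z≢)

  previous-snoc : ∀ {p u v z k} (P : NBWalk p u v k) (a : adj v z ≡ true) (z≢ : z ≢ previous P) →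
                  previous (snoc P a z≢) ≡ v
  previous-snoc nil a z≢ = refl
  previous-snoc (cons _ _ P) a z≢ = previous-snoc P a z≢

  record Arm (v t : Fin N) : Set where
    field
      {w z} : Fin N
      v~w : adj v w ≡ true
      w≢t : w ≢ t
      w~z : adj w z ≡ true
      z≢v : z ≢ v

  -- Equivalently, v has two arms whose first edges differ.
  Forked : Fin N → Set
  Forked v = ∀ t → Arm v t

  prependArm : ∀ {s t e} (P : NBWalk s s t e) (arm : Arm s (next P)) →
               NBWalk (Arm.z arm) (Arm.z arm) t (2 + e)
  prependArm P arm =
    cons (adj-sym G w~z) (adj⇒≢ G w~z) (cons (adj-sym G v~w) (λ s≡z → z≢v (sym s≡z)) (reenter P w≢t))
    where open Arm arm

  appendArm : ∀ {p u t e} (P : NBWalk p u t e) (arm : Arm t (previous P)) →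
              NBWalk p u (Arm.z arm) (2 + e)
  appendArm P arm = snoc (snoc P v~w w≢t) w~z (λ z≡ → z≢v (trans z≡ (previous-snoc P v~w w≢t)))
    where open Arm arm

  extendBothEnds : ∀ {s t e} → Forked s → Forked t → NBWalk s s t e → ∃₂ λ x y → NBWalk x x y (4 + e)
  extendBothEnds fs ft P = _ , _ , appendArm Q (ft (previous Q))
    where Q = prependArm P (fs (next P))

  fromStart : ∀ {p u v k} → NBWalk p u v k → NBWalk u u v k
  fromStart nil = nil
  fromStart (cons a _ P) = cons a (λ w≡u → adj⇒≢ G a (sym w≡u)) P

  walk⇒nbWalk : ∀ {u v k} → Walk G u v k → ∃ λ k′ → NBWalk u u v k′
  walk⇒nbWalk here = 0 , nil
  walk⇒nbWalk {u} (step a q) with walk⇒nbWalk q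
  ... | _ , nil = 1 , cons a (λ w≡u → adj⇒≢ G a (sym w≡u)) nil
  ... | _ , cons {w = w′} a′ w′≢w P with w′ ≟ᶠ u
  ...   | yes refl = _ , fromStart P
  ...   | no w′≢u = _ , cons a (λ w≡u → adj⇒≢ G a (sym w≡u)) (cons a′ w′≢u P)

  IsWalkList-++⁻ : ∀ xs {y ys} → IsWalkList G (xs ++ y ∷ ys) → IsWalkList G (xs ++ [ y ])
  IsWalkList-++⁻ [] _ = tt
  IsWalkList-++⁻ (x ∷ []) (a , _) = a , tt
  IsWalkList-++⁻ (x ∷ x′ ∷ xs) (a , walk) = a , IsWalkList-++⁻ (x′ ∷ xs) walk

  module _ (acyclic : ¬ Cycle G) where

    -- A vertex list starting at a neighbour w of u and first revisiting u after at least two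
    -- steps closes up, together with the edge u ~ w, into a cycle.
    no-return : ∀ {u w} → adj u w ≡ true → ∀ pre {post} →
                Unique (pre ++ u ∷ post) → IsWalkList G (pre ++ u ∷ post) →
                (∃ λ t → pre ++ u ∷ post ≡ w ∷ t) → (∀ t → pre ++ u ∷ post ≢ w ∷ u ∷ t) → ⊥
    no-return a [] _ _ (_ , refl) _ = adj⇒≢ G a refl
    no-return a (x ∷ []) {post} _ _ (_ , refl) not-back = not-back post refl
    no-return {u} a (x ∷ y ∷ r) unique walk (_ , refl) _ with Unique-++-∷⁻ (x ∷ y ∷ r) unique
    ... | u∉ , unique-pre =
      acyclic (u , x ∷ y ∷ r , s≤s (s≤s z≤n) , u∉ ∷ unique-pre , a , IsWalkList-++⁻ (x ∷ y ∷ r) walk)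

    nbWalk-unique : ∀ {p u v k} (P : NBWalk p u v k) → Unique (vertices P)
    nbWalk-unique nil = [] ∷ []
    nbWalk-unique (cons {u = u} a _ P) with u ∈? vertices P
    ... | no u∉ = ¬Any⇒All¬ _ u∉ ∷ nbWalk-unique P
    ... | yes u∈ with ∈-∃++ u∈
    ... | pre , _ , eq = ⊥-elim (no-return a pre
            (subst Unique eq (nbWalk-unique P))
            (subst (IsWalkList G) eq (vertices-walk P))
            (proj₁ (vertices-head P) , trans (sym eq) (proj₂ (vertices-head P)))
            (λ t eq′ → vertices-second P t (trans eq eq′)))

    nbWalk-not-closed : ∀ {p u k} → ¬ NBWalk p u u (suc k)
    nbWalk-not-closed (cons a w≢p P) with nbWalk-unique (cons a w≢p P)
    ... | u∉ ∷ _ = All¬⇒¬Any u∉ (last∈vertices P)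

    nbWalk-shortest : ∀ {p u v L k} → NBWalk p u v L → Walk G u v k → L ≤ k
    nbWalk-shortest nil _ = z≤n
    nbWalk-shortest P@(cons _ _ _) here = ⊥-elim (nbWalk-not-closed P)
    nbWalk-shortest (cons {w = w} a w≢p P) (step {w = w′} a′ q) with w′ ≟ᶠ w
    ... | yes refl = s≤s (nbWalk-shortest P q)
    ... | no w′≢w = ≤-trans (n≤1+n _) (≤-trans
            (nbWalk-shortest (cons (adj-sym G a′) (adj⇒≢ G a′) (cons a (λ w≡w′ → w′≢w (sym w≡w′)) P)) q)
            (n≤1+n _))

    nbWalk⇒distance≥ : ∀ {p s t L} → NBWalk p s t L → DistanceAtLeast G L
    nbWalk⇒distance≥ P with walk⇒dist (nbWalk⇒walk P)
    ... | d , dist = _ , _ , d , dist , nbWalk-shortest P (proj₁ dist)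

    forked-walk-distance≥ : ∀ {s t e} → Forked s → Forked t → NBWalk s s t e → DistanceAtLeast G (4 + e)
    forked-walk-distance≥ fs ft P = nbWalk⇒distance≥ (proj₂ (proj₂ (extendBothEnds fs ft P)))

    forked-distance≥4 : ∀ {a} → Forked a → DistanceAtLeast G 4
    forked-distance≥4 fa = forked-walk-distance≥ fa fa nil

    module _ (connected : Connected G) where

      two-forked-distance≥5 : ∀ {a b} → a ≢ b → Forked a → Forked b → DistanceAtLeast G 5
      two-forked-distance≥5 {a} {b} a≢b fa fb with walk⇒nbWalk (proj₂ (connected a b))
      ... | _ , nil = ⊥-elim (a≢b refl)
      ... | _ , P@(cons _ _ _) = DistanceAtLeast-mono (m≤m+n 5 _) (forked-walk-distance≥ fa fb P)

      three-forked-distance≥6 : ∀ {a b c} → a ≢ b → b ≢ c → c ≢ a →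
                                Forked a → Forked b → Forked c → DistanceAtLeast G 6
      three-forked-distance≥6 {a} {b} {c} a≢b b≢c c≢a fa fb fc
        with walk⇒nbWalk (proj₂ (connected a b)) | walk⇒nbWalk (proj₂ (connected c a))
      ... | _ , nil | _ = ⊥-elim (a≢b refl)
      ... | _ , P@(cons _ _ (cons _ _ _)) | _ = DistanceAtLeast-mono (m≤m+n 6 _) (forked-walk-distance≥ fa fb P)
      ... | _ , cons _ _ nil | _ , nil = ⊥-elim (c≢a refl)
      ... | _ , cons _ _ nil | _ , Q@(cons _ _ (cons _ _ _)) =
        DistanceAtLeast-mono (m≤m+n 6 _) (forked-walk-distance≥ fc fa Q)
      ... | _ , cons a~b _ nil | _ , cons c~a _ nil =
        forked-walk-distance≥ fc fb (cons c~a (λ a≡c → c≢a (sym a≡c)) (cons a~b (λ b≡c → b≢c b≡c) nil))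

      distinct-forked-distance≥ : ∀ m (v : Fin m → Fin N) → (∀ {i j} → i ≢ j → v i ≢ v j) →
                                  (∀ i → Forked (v i)) → 1 ≤ m → DistanceAtLeast G (predicted m)
      distinct-forked-distance≥ 1 v _ forked _ = forked-distance≥4 (forked zero)
      distinct-forked-distance≥ 2 v distinct forked _ =
        two-forked-distance≥5 (distinct λ ()) (forked zero) (forked (suc zero))
      distinct-forked-distance≥ (suc (suc (suc _))) v distinct forked _ =
        three-forked-distance≥6 (distinct λ ()) (distinct λ ()) (distinct λ ())
          (forked zero) (forked (suc zero)) (forked (suc (suc zero)))

  -- Signed degrees

  edgeValue : Fin N → Fin N → ℤ
  edgeValue v u = if adj v u then signValue (sign v u) else + 0

  sdeg≡sum : ∀ v → sdeg G v ≡ sum (edgeValue v)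
  sdeg≡sum v = trans (cong (foldr ℤ._+_ (+ 0)) (map-tabulate id (edgeValue v))) (foldr-tabulate (edgeValue v))

  NegEdge : Fin N → Fin N → Set
  NegEdge v u = adj v u ≡ true × sign v u ≡ minus

  negEdge? : ∀ v u → Dec (NegEdge v u)
  negEdge? v u with adj v u ≟ᵇ true | sign v u
  ... | yes a | minus = yes (a , refl)
  ... | yes _ | plus = no λ ()
  ... | no ¬a | _ = no λ (a , _) → ¬a a

  edgeValue≥-1 : ∀ v u → -[1+ 0 ] ℤ.≤ edgeValue v u
  edgeValue≥-1 v u with adj v u | sign v u
  ... | true | plus = ℤ.-≤+
  ... | true | minus = ℤ.-≤- z≤n
  ... | false | _ = ℤ.-≤+

  edgeValue≥0 : ∀ v u → ¬ NegEdge v u → + 0 ℤ.≤ edgeValue v u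
  edgeValue≥0 v u ¬neg with adj v u | sign v u
  ... | true | plus = ℤ.+≤+ z≤n
  ... | true | minus = ⊥-elim (¬neg (refl , refl))
  ... | false | _ = ℤ.+≤+ z≤n

  sdeg<-1⇒negEdge-avoiding : ∀ {v} → sdeg G v ℤ.< -[1+ 0 ] → ∀ t → ∃ λ w → w ≢ t × NegEdge v w
  sdeg<-1⇒negEdge-avoiding {v} sdeg<-1 t with any? (λ w → ¬? (w ≟ᶠ t) ×-dec negEdge? v w)
  ... | yes (w , w≢t , neg) = w , w≢t , neg
  ... | no none = ⊥-elim (ℤP.<⇒≱ sdeg<-1 (subst (-[1+ 0 ] ℤ.≤_) (sym (sdeg≡sum v))
          (sum-≥-1 t (edgeValue≥-1 v t) λ w w≢t → edgeValue≥0 v w λ neg → none (w , w≢t , neg))))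

  leaf-sdeg : ∀ {w v} → adj w v ≡ true → (∀ z → adj w z ≡ true → z ≡ v) → sdeg G w ≡ signValue (sign w v)
  leaf-sdeg {w} {v} w~v only-v = trans (sdeg≡sum w) (trans (sum-single v others) edge)
    where
    others : ∀ z → z ≢ v → edgeValue w z ≡ + 0
    others z z≢v with adj w z in w~z
    ... | true = ⊥-elim (z≢v (only-v z w~z))
    ... | false = refl
    edge : edgeValue w v ≡ signValue (sign w v)
    edge rewrite w~v = refl

  negEdge⇒arm : ∀ {v w} → NegEdge v w → sdeg G w ≢ -[1+ 0 ] → ∃ λ z → adj w z ≡ true × z ≢ v
  negEdge⇒arm {v} {w} (v~w , minus-edge) sdeg≢-1 with any? (λ z → (adj w z ≟ᵇ true) ×-dec ¬? (z ≟ᶠ v))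
  ... | yes (z , w~z , z≢v) = z , w~z , z≢v
  ... | no none = ⊥-elim (sdeg≢-1 (trans (leaf-sdeg (adj-sym G v~w) only-v)
                    (cong signValue (trans (signSym w v) minus-edge))))
    where
    only-v : ∀ z → adj w z ≡ true → z ≡ v
    only-v z w~z with z ≟ᶠ v
    ... | yes z≡v = z≡v
    ... | no z≢v = ⊥-elim (none (z , w~z , z≢v))

  -- A vertex of signed degree < -1 has two negative edges, and none of them leads to a leaf
  -- when -1 is not a signed degree.
  sdeg<-1⇒forked : ∀ {v} → sdeg G v ℤ.< -[1+ 0 ] → (∀ w → sdeg G w ≢ -[1+ 0 ]) → Forked v
  sdeg<-1⇒forked sdeg<-1 no-1 t with sdeg<-1⇒negEdge-avoiding sdeg<-1 t
  ... | w , w≢t , neg with negEdge⇒arm neg (no-1 w)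
  ... | z , w~z , z≢v = record { v~w = proj₁ neg ; w≢t = w≢t ; w~z = w~z ; z≢v = z≢v }

lowerBound : ∀ G → IsTree G → (∀ w → sdeg G w ≢ -[1+ 0 ]) →
             ∀ m (y : Fin m → ℤ) → Injective _≡_ _≡_ y → (∀ i → y i ℤ.< -[1+ 0 ]) →
             (∀ i → ∃ λ v → sdeg G v ≡ y i) → 1 ≤ m → DistanceAtLeast G (predicted m)
lowerBound G (_ , connected , acyclic) no-1 m y y-inj y<-1 attained =
  distinct-forked-distance≥ G acyclic connected m vertex distinct forked
  where
  vertex : Fin m → Fin (SignedGraph.N G)
  vertex i = proj₁ (attained i)
  distinct : ∀ {i j} → i ≢ j → vertex i ≢ vertex j
  distinct {i} {j} i≢j eq =
    i≢j (y-inj (trans (sym (proj₂ (attained i))) (trans (cong (sdeg G) eq) (proj₂ (attained j)))))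
  forked : ∀ i → Forked G (vertex i)
  forked i = sdeg<-1⇒forked G (subst (ℤ._< -[1+ 0 ]) (sym (proj₂ (attained i))) (y<-1 i)) no-1

-- Rooted trees

module RankedGraph (G : SignedGraph) (rank : Fin (SignedGraph.N G) → ℕ)
  (rank-adj : ∀ {u w} → SignedGraph.adj G u w ≡ true → rank u ≢ rank w)
  (lower-unique : ∀ {u w w′} → SignedGraph.adj G u w ≡ true → SignedGraph.adj G u w′ ≡ true →
                  rank w < rank u → rank w′ < rank u → w ≡ w′)
  where
  open SignedGraph G

  NonBacktracking : List (Fin N) → Set
  NonBacktracking (x ∷ y ∷ z ∷ r) = x ≢ z × NonBacktracking (y ∷ z ∷ r)
  NonBacktracking _ = ⊤

  lastOf : Fin N → List (Fin N) → Fin N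
  lastOf a [] = a
  lastOf a (b ∷ r) = lastOf b r

  penultimateOf : Fin N → Fin N → List (Fin N) → Fin N
  penultimateOf a b [] = a
  penultimateOf a b (c ∷ r) = penultimateOf b c r

  rank-<⊎> : ∀ {u w} → adj u w ≡ true → rank u < rank w ⊎ rank w < rank u
  rank-<⊎> {u} {w} u~w with <-cmp (rank u) (rank w)
  ... | tri< lt _ _ = inj₁ lt
  ... | tri≈ _ eq _ = ⊥-elim (rank-adj u~w eq)
  ... | tri> _ _ gt = inj₂ gt

  last-step : ∀ a b r → IsWalkList G (a ∷ b ∷ r) → adj (penultimateOf a b r) (lastOf b r) ≡ true
  last-step a b [] (a~b , _) = a~b
  last-step a b (c ∷ r) (_ , walk) = last-step b c r walk

  -- The lower neighbour is unique, so a non-backtracking walk that has gone up keeps going up.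
  rising : ∀ a b r → IsWalkList G (a ∷ b ∷ r) → NonBacktracking (a ∷ b ∷ r) → rank a < rank b →
           rank a < rank (lastOf b r) × rank (penultimateOf a b r) < rank (lastOf b r)
  rising a b [] _ _ a<b = a<b , a<b
  rising a b (c ∷ r) (a~b , b~c , walk) (a≢c , nb) a<b with rank-<⊎> b~c
  ... | inj₂ c<b = ⊥-elim (a≢c (lower-unique (adj-sym G a~b) b~c a<b c<b))
  ... | inj₁ b<c = map₁ (<-trans a<b) (rising b c r (b~c , walk) nb b<c)

  falling : ∀ a b r → IsWalkList G (a ∷ b ∷ r) → NonBacktracking (a ∷ b ∷ r) →
            rank (lastOf b r) < rank (penultimateOf a b r) → rank (lastOf b r) < rank a
  falling a b [] _ _ b<a = b<a
  falling a b (c ∷ r) (a~b , walk) (a≢c , nb) last<pen with rank-<⊎> a~b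
  ... | inj₂ b<a = <-trans (falling b c r walk nb last<pen) b<a
  ... | inj₁ a<b = ⊥-elim (<-asym last<pen (proj₂ (rising a b (c ∷ r) (a~b , walk) (a≢c , nb) a<b)))

  lastOf-++ : ∀ b r {v} → lastOf b (r ++ [ v ]) ≡ v
  lastOf-++ b [] = refl
  lastOf-++ b (c ∷ r) = lastOf-++ c r

  penultimateOf-++ : ∀ a b r {v} → penultimateOf a b (r ++ [ v ]) ≡ lastOf b r
  penultimateOf-++ a b [] = refl
  penultimateOf-++ a b (c ∷ r) = penultimateOf-++ b c r

  closedWalk-nonBacktracking : ∀ {v} a b r → Unique (a ∷ b ∷ r) → All (v ≢_) (b ∷ r) → (r ≢ [] ⊎ a ≢ v) →
                               NonBacktracking (a ∷ b ∷ r ++ [ v ])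
  closedWalk-nonBacktracking a b [] _ _ (inj₁ r≢[]) = ⊥-elim (r≢[] refl)
  closedWalk-nonBacktracking a b [] _ _ (inj₂ a≢v) = a≢v , tt
  closedWalk-nonBacktracking a b (c ∷ r) ((_ ∷ a≢c ∷ _) ∷ unique) (v≢b ∷ v∉) _ =
    a≢c , closedWalk-nonBacktracking b c r unique v∉ (inj₂ λ b≡v → v≢b (sym b≡v))

  ∉⇒≢lastOf : ∀ {b} c r → All (b ≢_) (c ∷ r) → b ≢ lastOf c r
  ∉⇒≢lastOf c [] (b≢c ∷ _) = b≢c
  ∉⇒≢lastOf c (d ∷ r) (_ ∷ b∉) = ∉⇒≢lastOf d r b∉

  rank-acyclic : ¬ Cycle G
  rank-acyclic (_ , [] , () , _)
  rank-acyclic (_ , _ ∷ [] , s≤s () , _)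
  rank-acyclic (v , x₁ ∷ x₂ ∷ rest , _ , unique@(v∉ ∷ x₁∉ ∷ _) , v~x₁ , walk) = impossible (rank-<⊎> v~x₁)
    where
    r = x₂ ∷ rest
    closed : IsWalkList G (v ∷ x₁ ∷ r ++ [ v ])
    closed = v~x₁ , walk
    nb : NonBacktracking (v ∷ x₁ ∷ r ++ [ v ])
    nb = closedWalk-nonBacktracking v x₁ r unique v∉ (inj₁ λ ())
    lastOf≡v : lastOf x₁ (r ++ [ v ]) ≡ v
    lastOf≡v = lastOf-++ x₁ r
    pen = lastOf x₁ r
    pen~v : adj pen v ≡ true
    pen~v = subst₂ (λ p q → adj p q ≡ true) (penultimateOf-++ v x₁ r) lastOf≡v (last-step v x₁ (r ++ [ v ]) closed)
    impossible : rank v < rank x₁ ⊎ rank x₁ < rank v → ⊥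
    impossible (inj₁ v<x₁) =
      <-irrefl refl (subst (rank v <_) (cong rank lastOf≡v) (proj₁ (rising v x₁ (r ++ [ v ]) closed nb v<x₁)))
    impossible (inj₂ x₁<v) with rank-<⊎> pen~v
    ... | inj₁ pen<v = ∉⇒≢lastOf x₂ rest x₁∉ (lower-unique v~x₁ (adj-sym G pen~v) x₁<v pen<v)
    ... | inj₂ v<pen = <-irrefl refl (subst (_< rank v) (cong rank lastOf≡v) (falling v x₁ (r ++ [ v ]) closed nb
                         (subst₂ (λ p q → rank p < rank q) (sym lastOf≡v) (sym (penultimateOf-++ v x₁ r)) v<pen)))

-- Rooted at vertex zero; the rank (the depth, in all trees built below) certifies acyclicity.
record RootedTree : Set where
  field
    n        : ℕ
    adj      : Fin (suc n) → Fin (suc n) → Bool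
    adjSym   : ∀ u v → adj u v ≡ adj v u
    adjIrr   : ∀ v → adj v v ≡ false
    sign     : Fin (suc n) → Fin (suc n) → Sign
    signSym  : ∀ u v → sign u v ≡ sign v u
    rank     : Fin (suc n) → ℕ
    rank-root    : rank zero ≡ 0
    rank-adj     : ∀ {u w} → adj u w ≡ true → rank u ≢ rank w
    lower-unique : ∀ {u w w′} → adj u w ≡ true → adj u w′ ≡ true → rank w < rank u → rank w′ < rank u → w ≡ w′

  graph : SignedGraph
  graph = record { N = suc n ; adj = adj ; adjSym = adjSym ; adjIrr = adjIrr ; sign = sign ; signSym = signSym }

  rootDeg : ℤ
  rootDeg = sdeg graph zero

open RootedTree using (graph; rootDeg)

HeightAtMost : RootedTree → ℕ → Set
HeightAtMost t h = ∀ u → ∃ λ l → l ≤ h × Walk (graph t) u zero l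

WalksAtMost : RootedTree → ℕ → Set
WalksAtMost t P = ∀ u v → ∃ λ l → l ≤ P × Walk (graph t) u v l

NonRootDegreesIn : RootedTree → (ℤ → Set) → Set
NonRootDegreesIn t D = ∀ v → D (sdeg (graph t) (suc v))

NonRootAttains : RootedTree → ℤ → Set
NonRootAttains t z = ∃ λ v → sdeg (graph t) (suc v) ≡ z

HeightAtMost-mono : ∀ t {h h′} → h ≤ h′ → HeightAtMost t h → HeightAtMost t h′
HeightAtMost-mono t h≤h′ height u with height u
... | l , l≤h , walk = l , ≤-trans l≤h h≤h′ , walk

WalksAtMost-mono : ∀ t {P P′} → P ≤ P′ → WalksAtMost t P → WalksAtMost t P′
WalksAtMost-mono t P≤P′ walks u v with walks u v
... | l , l≤P , walk = l , ≤-trans l≤P P≤P′ , walk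

WalksAtMost⇒IsTree : ∀ t {P} → WalksAtMost t P → IsTree (graph t)
WalksAtMost⇒IsTree t walks = s≤s z≤n , (λ u v → _ , proj₂ (proj₂ (walks u v))) ,
  RankedGraph.rank-acyclic (graph t) (RootedTree.rank t) (RootedTree.rank-adj t) (RootedTree.lower-unique t)

single : RootedTree
single = record
  { n = 0 ; adj = λ _ _ → false ; adjSym = λ _ _ → refl ; adjIrr = λ _ → refl
  ; sign = λ _ _ → plus ; signSym = λ _ _ → refl
  ; rank = λ _ → 0 ; rank-root = refl ; rank-adj = λ () ; lower-unique = λ () }

single-height : ∀ {h} → HeightAtMost single h
single-height zero = 0 , z≤n , here

single-walks : ∀ {P} → WalksAtMost single P
single-walks zero zero = 0 , z≤n , here

isRoot : ∀ {k} → Fin k → Bool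
isRoot zero = true
isRoot (suc _) = false

isRoot∧isRoot : ∀ {k l} (a : Fin (suc k)) (b : Fin (suc l)) → isRoot a ∧ isRoot b ≡ true → a ≡ zero × b ≡ zero
isRoot∧isRoot zero zero _ = refl , refl
isRoot∧isRoot zero (suc _) ()
isRoot∧isRoot (suc _) _ ()

rootEdge : ∀ {k} → Sign → Fin k → ℤ
rootEdge s zero = signValue s
rootEdge s (suc _) = + 0

-- H hung below the root of G by an edge of sign s joining the two roots; the vertices of H
-- come after those of G and their ranks go up by one.
module Attach (G H : RootedTree) (s : Sign) where
  private
    module G = RootedTree G
    module H = RootedTree H

  m k : ℕ
  m = suc G.n
  k = suc H.n

  Vertex : Set
  Vertex = Fin m ⊎ Fin k

  adjᵛ : Vertex → Vertex → Bool
  adjᵛ (inj₁ a) (inj₁ b) = G.adj a b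
  adjᵛ (inj₂ a) (inj₂ b) = H.adj a b
  adjᵛ (inj₁ a) (inj₂ b) = isRoot a ∧ isRoot b
  adjᵛ (inj₂ a) (inj₁ b) = isRoot a ∧ isRoot b

  signᵛ : Vertex → Vertex → Sign
  signᵛ (inj₁ a) (inj₁ b) = G.sign a b
  signᵛ (inj₂ a) (inj₂ b) = H.sign a b
  signᵛ _ _ = s

  rankᵛ : Vertex → ℕ
  rankᵛ (inj₁ a) = G.rank a
  rankᵛ (inj₂ b) = suc (H.rank b)

  adjᵛ-sym : ∀ x y → adjᵛ x y ≡ adjᵛ y x
  adjᵛ-sym (inj₁ a) (inj₁ b) = G.adjSym a b
  adjᵛ-sym (inj₂ a) (inj₂ b) = H.adjSym a b
  adjᵛ-sym (inj₁ a) (inj₂ b) = ∧-comm (isRoot a) (isRoot b)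
  adjᵛ-sym (inj₂ a) (inj₁ b) = ∧-comm (isRoot a) (isRoot b)

  adjᵛ-irr : ∀ x → adjᵛ x x ≡ false
  adjᵛ-irr (inj₁ a) = G.adjIrr a
  adjᵛ-irr (inj₂ b) = H.adjIrr b

  signᵛ-sym : ∀ x y → signᵛ x y ≡ signᵛ y x
  signᵛ-sym (inj₁ a) (inj₁ b) = G.signSym a b
  signᵛ-sym (inj₂ a) (inj₂ b) = H.signSym a b
  signᵛ-sym (inj₁ a) (inj₂ b) = refl
  signᵛ-sym (inj₂ a) (inj₁ b) = refl

  rankᵛ-adj : ∀ {x y} → adjᵛ x y ≡ true → rankᵛ x ≢ rankᵛ y
  rankᵛ-adj {inj₁ a} {inj₁ b} a~b = G.rank-adj a~b
  rankᵛ-adj {inj₂ a} {inj₂ b} a~b = H.rank-adj a~b ∘ suc-injective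
  rankᵛ-adj {inj₁ a} {inj₂ b} a~b with isRoot∧isRoot a b a~b
  ... | refl , refl = λ eq → 0≢1+n (trans (sym G.rank-root) eq)
  rankᵛ-adj {inj₂ a} {inj₁ b} a~b with isRoot∧isRoot a b a~b
  ... | refl , refl = λ eq → 0≢1+n (trans (sym G.rank-root) (sym eq))

  no-lower-across : ∀ a b → isRoot a ∧ isRoot b ≡ true → ¬ (suc (H.rank b) < G.rank a)
  no-lower-across a b a~b lt with isRoot∧isRoot a b a~b
  ... | refl , refl with subst (suc (H.rank b) <_) G.rank-root lt
  ... | ()

  no-lower-below-rootH : ∀ {b} → ¬ (suc (H.rank b) < suc (H.rank zero))
  no-lower-below-rootH {b} lt with subst (H.rank b <_) H.rank-root (≤-pred lt)
  ... | ()

  lowerᵛ-unique : ∀ {x y y′} → adjᵛ x y ≡ true → adjᵛ x y′ ≡ true → rankᵛ y < rankᵛ x → rankᵛ y′ < rankᵛ x → y ≡ y′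
  lowerᵛ-unique {inj₁ a} {inj₁ b} {inj₁ b′} e e′ l l′ = cong inj₁ (G.lower-unique e e′ l l′)
  lowerᵛ-unique {inj₁ a} {inj₂ b} e _ l _ = ⊥-elim (no-lower-across a b e l)
  lowerᵛ-unique {inj₁ a} {inj₁ b} {inj₂ b′} _ e′ _ l′ = ⊥-elim (no-lower-across a b′ e′ l′)
  lowerᵛ-unique {inj₂ a} {inj₂ b} {inj₂ b′} e e′ l l′ = cong inj₂ (H.lower-unique e e′ (≤-pred l) (≤-pred l′))
  lowerᵛ-unique {inj₂ a} {inj₁ b} {inj₁ b′} e e′ _ _ with isRoot∧isRoot a b e | isRoot∧isRoot a b′ e′
  ... | refl , refl | _ , refl = refl
  lowerᵛ-unique {inj₂ a} {inj₁ b} {inj₂ b′} e _ _ l′ with isRoot∧isRoot a b e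
  ... | refl , refl = ⊥-elim (no-lower-below-rootH l′)
  lowerᵛ-unique {inj₂ a} {inj₂ b} {inj₁ b′} _ e′ l _ with isRoot∧isRoot a b′ e′
  ... | refl , refl = ⊥-elim (no-lower-below-rootH l)

  split : Fin (m + k) → Vertex
  split = splitAt m

  split-injective : ∀ {u w} → split u ≡ split w → u ≡ w
  split-injective {u} {w} eq = trans (sym (join-splitAt m k u)) (trans (cong (join m k) eq) (join-splitAt m k w))

  tree : RootedTree
  tree = record
    { n = G.n + k
    ; adj = λ u w → adjᵛ (split u) (split w)
    ; adjSym = λ u w → adjᵛ-sym (split u) (split w)
    ; adjIrr = λ u → adjᵛ-irr (split u)
    ; sign = λ u w → signᵛ (split u) (split w)
    ; signSym = λ u w → signᵛ-sym (split u) (split w)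
    ; rank = λ u → rankᵛ (split u)
    ; rank-root = G.rank-root
    ; rank-adj = λ {u} {w} → rankᵛ-adj {split u} {split w}
    ; lower-unique = λ {u} {w} {w′} e e′ l l′ →
        split-injective (lowerᵛ-unique {split u} {split w} {split w′} e e′ l l′)
    }

  private
    T = graph tree

  inG : Fin m → Fin (m + k)
  inG a = a ↑ˡ k

  inH : Fin k → Fin (m + k)
  inH b = m ↑ʳ b

  split-inG : ∀ a → split (inG a) ≡ inj₁ a
  split-inG a = splitAt-↑ˡ m a k

  split-inH : ∀ b → split (inH b) ≡ inj₂ b
  split-inH b = splitAt-↑ʳ m k b

  view : ∀ u → (∃ λ a → inG a ≡ u) ⊎ (∃ λ b → inH b ≡ u)
  view u with split u in eq
  ... | inj₁ a = inj₁ (a , splitAt⁻¹-↑ˡ eq)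
  ... | inj₂ b = inj₂ (b , splitAt⁻¹-↑ʳ eq)

  liftG : ∀ {a b l} → Walk (graph G) a b l → Walk T (inG a) (inG b) l
  liftG here = here
  liftG (step {u = a} {w = c} a~c walk) =
    step (subst₂ (λ x y → adjᵛ x y ≡ true) (sym (split-inG a)) (sym (split-inG c)) a~c) (liftG walk)

  liftH : ∀ {a b l} → Walk (graph H) a b l → Walk T (inH a) (inH b) l
  liftH here = here
  liftH (step {u = a} {w = c} a~c walk) =
    step (subst₂ (λ x y → adjᵛ x y ≡ true) (sym (split-inH a)) (sym (split-inH c)) a~c) (liftH walk)

  bridge : SignedGraph.adj T zero (inH zero) ≡ true
  bridge = subst (λ y → adjᵛ (inj₁ zero) y ≡ true) (sym (split-inH zero)) refl

  down-from-H : ∀ {b l} → Walk (graph H) b zero l → Walk T (inH b) zero (suc l)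
  down-from-H walk = reverseʷ (step bridge (reverseʷ (liftH walk)))

  height : ∀ {h h′} → HeightAtMost G h → HeightAtMost H h′ → suc h′ ≤ h → HeightAtMost tree h
  height heightG heightH h′<h u with view u
  ... | inj₁ (a , refl) with heightG a
  ...   | l , l≤h , walk = l , l≤h , liftG walk
  height heightG heightH h′<h u | inj₂ (b , refl) with heightH b
  ...   | l , l≤h′ , walk = suc l , ≤-trans (s≤s l≤h′) h′<h , down-from-H walk

  across : ∀ {hG hH P} → HeightAtMost G hG → HeightAtMost H hH → hG + suc hH ≤ P →
           ∀ b a → ∃ λ l → l ≤ P × Walk T (inH b) (inG a) l
  across {hG} {hH} {P} heightG heightH fits b a with heightH b | heightG a
  ... | l₁ , l₁≤ , walk₁ | l₂ , l₂≤ , walk₂ =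
    suc l₁ + l₂ , ≤-trans (ℕP.+-mono-≤ (s≤s l₁≤) l₂≤) (subst (_≤ P) (ℕP.+-comm hG (suc hH)) fits) ,
    (down-from-H walk₁ ++ʷ reverseʷ (liftG walk₂))

  walks : ∀ {hG hH P} → HeightAtMost G hG → HeightAtMost H hH → WalksAtMost G P → WalksAtMost H P →
          hG + suc hH ≤ P → WalksAtMost tree P
  walks heightG heightH walksG walksH fits u v with view u | view v
  ... | inj₁ (a , refl) | inj₁ (b , refl) = map₂ (map₂ liftG) (walksG a b)
  ... | inj₂ (a , refl) | inj₂ (b , refl) = map₂ (map₂ liftH) (walksH a b)
  ... | inj₁ (a , refl) | inj₂ (b , refl) = map₂ (map₂ reverseʷ) (across heightG heightH fits b a)
  ... | inj₂ (b , refl) | inj₁ (a , refl) = across heightG heightH fits b a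

  edgeᵛ : Vertex → Vertex → ℤ
  edgeᵛ x y = if adjᵛ x y then signValue (signᵛ x y) else + 0

  bridge-sumᴳ : ∀ a → sum (λ j → edgeᵛ (inj₁ a) (inj₂ j)) ≡ rootEdge s a
  bridge-sumᴳ zero = trans (cong (ℤ._+_ (signValue s)) (sum-replicate-zero H.n)) (ℤP.+-identityʳ _)
  bridge-sumᴳ (suc a) = sum-replicate-zero k

  bridge-sumᴴ : ∀ b → sum (λ j → edgeᵛ (inj₂ b) (inj₁ j)) ≡ rootEdge s b
  bridge-sumᴴ zero = trans (cong (ℤ._+_ (signValue s)) (sum-replicate-zero G.n)) (ℤP.+-identityʳ _)
  bridge-sumᴴ (suc b) = sum-replicate-zero m

  sdeg-inG : ∀ a → sdeg T (inG a) ≡ sdeg (graph G) a ℤ.+ rootEdge s a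
  sdeg-inG a = begin
    sdeg T (inG a)                                               ≡⟨ sdeg≡sum T (inG a) ⟩
    sum (edgeValue T (inG a))                                    ≡⟨ sum-++ m k (edgeValue T (inG a)) ⟩
    sum (λ j → edgeValue T (inG a) (inG j)) ℤ.+ sum (λ j → edgeValue T (inG a) (inH j))
      ≡⟨ cong₂ ℤ._+_ (sum-cong-≗ λ j → cong₂ edgeᵛ (split-inG a) (split-inG j))
                     (sum-cong-≗ λ j → cong₂ edgeᵛ (split-inG a) (split-inH j)) ⟩
    sum (edgeValue (graph G) a) ℤ.+ sum (λ j → edgeᵛ (inj₁ a) (inj₂ j))
      ≡⟨ cong₂ ℤ._+_ (sym (sdeg≡sum (graph G) a)) (bridge-sumᴳ a) ⟩
    sdeg (graph G) a ℤ.+ rootEdge s a                            ∎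
    where open ≡-Reasoning

  sdeg-inH : ∀ b → sdeg T (inH b) ≡ rootEdge s b ℤ.+ sdeg (graph H) b
  sdeg-inH b = begin
    sdeg T (inH b)                                               ≡⟨ sdeg≡sum T (inH b) ⟩
    sum (edgeValue T (inH b))                                    ≡⟨ sum-++ m k (edgeValue T (inH b)) ⟩
    sum (λ j → edgeValue T (inH b) (inG j)) ℤ.+ sum (λ j → edgeValue T (inH b) (inH j))
      ≡⟨ cong₂ ℤ._+_ (sum-cong-≗ λ j → cong₂ edgeᵛ (split-inH b) (split-inG j))
                     (sum-cong-≗ λ j → cong₂ edgeᵛ (split-inH b) (split-inH j)) ⟩
    sum (λ j → edgeᵛ (inj₂ b) (inj₁ j)) ℤ.+ sum (edgeValue (graph H) b)
      ≡⟨ cong₂ ℤ._+_ (bridge-sumᴴ b) (sym (sdeg≡sum (graph H) b)) ⟩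
    rootEdge s b ℤ.+ sdeg (graph H) b                            ∎
    where open ≡-Reasoning

  rootDeg-tree : rootDeg tree ≡ rootDeg G ℤ.+ signValue s
  rootDeg-tree = sdeg-inG zero

  nonRootDegreesIn : ∀ {D : ℤ → Set} → NonRootDegreesIn G D → NonRootDegreesIn H D →
                     D (signValue s ℤ.+ rootDeg H) → NonRootDegreesIn tree D
  nonRootDegreesIn {D} inDᴳ inDᴴ rootH∈D v with view (suc v)
  ... | inj₁ (zero , ())
  ... | inj₁ (suc a , refl) = subst D (sym (trans (sdeg-inG (suc a)) (ℤP.+-identityʳ _))) (inDᴳ a)
  ... | inj₂ (zero , refl) = subst D (sym (sdeg-inH zero)) rootH∈D
  ... | inj₂ (suc b , refl) = subst D (sym (trans (sdeg-inH (suc b)) (ℤP.+-identityˡ _))) (inDᴴ b)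

  attainsᴳ : ∀ {z} → NonRootAttains G z → NonRootAttains tree z
  attainsᴳ (a , eq) = a ↑ˡ k , trans (sdeg-inG (suc a)) (trans (ℤP.+-identityʳ _) eq)

  attainsᴴ : ∀ {z} → NonRootAttains H z → NonRootAttains tree z
  attainsᴴ (b , eq) = G.n ↑ʳ suc b , trans (sdeg-inH (suc b)) (trans (ℤP.+-identityˡ _) eq)

  attains-rootH : NonRootAttains tree (signValue s ℤ.+ rootDeg H)
  attains-rootH = G.n ↑ʳ zero , sdeg-inH zero

attach : RootedTree → Sign → RootedTree → RootedTree
attach G s H = Attach.tree G H s

attachAll : RootedTree → Sign → ∀ {k} → (Fin k → RootedTree) → RootedTree
attachAll G s {zero} f = G
attachAll G s {suc k} f = attachAll (attach G s (f zero)) s (f ∘ suc)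

module _ (s : Sign) where

  attachAll-rootDeg : ∀ G {k} (f : Fin k → RootedTree) → rootDeg (attachAll G s f) ≡ rootDeg G ℤ.+ + k ℤ.* signValue s
  attachAll-rootDeg G {zero} f = sym (ℤP.+-identityʳ _)
  attachAll-rootDeg G {suc k} f = begin
    rootDeg (attachAll (attach G s (f zero)) s (f ∘ suc))  ≡⟨ attachAll-rootDeg (attach G s (f zero)) (f ∘ suc) ⟩
    rootDeg (attach G s (f zero)) ℤ.+ + k ℤ.* signValue s
      ≡⟨ cong (ℤ._+ + k ℤ.* signValue s) (Attach.rootDeg-tree G (f zero) s) ⟩
    rootDeg G ℤ.+ signValue s ℤ.+ + k ℤ.* signValue s         ≡⟨ one-more (rootDeg G) (signValue s) (+ k) ⟩
    rootDeg G ℤ.+ + suc k ℤ.* signValue s                     ∎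
    where
    open ≡-Reasoning
    one-more : ∀ a e K → a ℤ.+ e ℤ.+ K ℤ.* e ≡ a ℤ.+ (+ 1 ℤ.+ K) ℤ.* e
    one-more = solve-∀

  attachAll-height : ∀ {h h′} G {k} (f : Fin k → RootedTree) → HeightAtMost G h → (∀ i → HeightAtMost (f i) h′) →
                     suc h′ ≤ h → HeightAtMost (attachAll G s f) h
  attachAll-height G {zero} f heightG _ _ = heightG
  attachAll-height G {suc k} f heightG heightf h′<h =
    attachAll-height (attach G s (f zero)) (f ∘ suc) (Attach.height G (f zero) s heightG (heightf zero) h′<h)
      (heightf ∘ suc) h′<h

  attachAll-walks : ∀ {hG hf P} G {k} (f : Fin k → RootedTree) →
                    HeightAtMost G hG → (∀ i → HeightAtMost (f i) hf) → WalksAtMost G P → (∀ i → WalksAtMost (f i) P) →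
                    suc hf ≤ hG → hG + suc hf ≤ P → WalksAtMost (attachAll G s f) P
  attachAll-walks G {zero} f _ _ walksG _ _ _ = walksG
  attachAll-walks G {suc k} f heightG heightf walksG walksf hf<hG fits =
    attachAll-walks (attach G s (f zero)) (f ∘ suc)
      (Attach.height G (f zero) s heightG (heightf zero) hf<hG) (heightf ∘ suc)
      (Attach.walks G (f zero) s heightG (heightf zero) walksG (walksf zero) fits) (walksf ∘ suc) hf<hG fits

  attachAll-nonRootDegreesIn : ∀ {D} G {k} (f : Fin k → RootedTree) → NonRootDegreesIn G D →
                               (∀ i → NonRootDegreesIn (f i) D) → (∀ i → D (signValue s ℤ.+ rootDeg (f i))) →
                               NonRootDegreesIn (attachAll G s f) D
  attachAll-nonRootDegreesIn G {zero} f inDᴳ _ _ = inDᴳ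
  attachAll-nonRootDegreesIn {D} G {suc k} f inDᴳ inDᶠ roots∈D =
    attachAll-nonRootDegreesIn {D} (attach G s (f zero)) (f ∘ suc)
      (Attach.nonRootDegreesIn G (f zero) s {D} inDᴳ (inDᶠ zero) (roots∈D zero)) (inDᶠ ∘ suc) (roots∈D ∘ suc)

  attachAll-attainsᴳ : ∀ {z} G {k} (f : Fin k → RootedTree) → NonRootAttains G z → NonRootAttains (attachAll G s f) z
  attachAll-attainsᴳ G {zero} f attains = attains
  attachAll-attainsᴳ G {suc k} f attains =
    attachAll-attainsᴳ (attach G s (f zero)) (f ∘ suc) (Attach.attainsᴳ G (f zero) s attains)

  attachAll-attainsᶠ : ∀ {z} G {k} (f : Fin k → RootedTree) i → NonRootAttains (f i) z → NonRootAttains (attachAll G s f) z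
  attachAll-attainsᶠ G f zero attains =
    attachAll-attainsᴳ (attach G s (f zero)) (f ∘ suc) (Attach.attainsᴴ G (f zero) s attains)
  attachAll-attainsᶠ G f (suc i) attains = attachAll-attainsᶠ (attach G s (f zero)) (f ∘ suc) i attains

  attachAll-attains-root : ∀ G {k} (f : Fin k → RootedTree) i →
                           NonRootAttains (attachAll G s f) (signValue s ℤ.+ rootDeg (f i))
  attachAll-attains-root G f zero = attachAll-attainsᴳ (attach G s (f zero)) (f ∘ suc) (Attach.attains-rootH G (f zero) s)
  attachAll-attains-root G f (suc i) = attachAll-attains-root (attach G s (f zero)) (f ∘ suc) i

-- The extremal trees

singles : ∀ j → Fin j → RootedTree
singles _ _ = single

star : ℕ → RootedTree
star j = attachAll single plus (singles j)

star-rootDeg : ∀ j → rootDeg (star j) ≡ + j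
star-rootDeg j = trans (attachAll-rootDeg plus single (singles j)) (trans (ℤP.+-identityˡ _) (ℤP.*-identityʳ (+ j)))

star-height : ∀ j → HeightAtMost (star j) 1
star-height j = attachAll-height plus single (singles j) single-height (λ _ → single-height) ≤-refl

star-walks : ∀ j → WalksAtMost (star j) 2
star-walks j = attachAll-walks plus {1} {0} single (singles j) single-height (λ _ → single-height)
  single-walks (λ _ → single-walks) ≤-refl ≤-refl

star-nonRootDegreesIn : ∀ {D} j → D (+ 1) → NonRootDegreesIn (star j) D
star-nonRootDegreesIn {D} j 1∈D = attachAll-nonRootDegreesIn plus {D} single (singles j) (λ ()) (λ _ ()) (λ _ → 1∈D)

star-attains-1 : ∀ j → NonRootAttains (star (suc j)) (+ 1)
star-attains-1 j = attachAll-attains-root plus single (singles (suc j)) zero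

hangStars : RootedTree → Sign → ∀ {k} → (Fin k → ℕ) → RootedTree
hangStars G s f = attachAll G s (star ∘ f)

module _ (s : Sign) {k} (f : Fin k → ℕ) where

  hangStars-rootDeg : ∀ G → rootDeg (hangStars G s f) ≡ rootDeg G ℤ.+ + k ℤ.* signValue s
  hangStars-rootDeg G = attachAll-rootDeg s G (star ∘ f)

  hangStars-height : ∀ G → HeightAtMost G 2 → HeightAtMost (hangStars G s f) 2
  hangStars-height G heightG = attachAll-height s G (star ∘ f) heightG (star-height ∘ f) ≤-refl

  hangStars-walks : ∀ G → HeightAtMost G 2 → WalksAtMost G 4 → WalksAtMost (hangStars G s f) 4
  hangStars-walks G heightG walksG = attachAll-walks s G (star ∘ f) heightG (star-height ∘ f)
    walksG (λ i → WalksAtMost-mono (star (f i)) (m≤m+n 2 2) (star-walks (f i))) ≤-refl ≤-refl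

  hangStars-nonRootDegreesIn : ∀ {D} G → NonRootDegreesIn G D → D (+ 1) → (∀ i → D (signValue s ℤ.+ + f i)) →
                               NonRootDegreesIn (hangStars G s f) D
  hangStars-nonRootDegreesIn {D} G inDᴳ 1∈D values∈D =
    attachAll-nonRootDegreesIn s {D} G (star ∘ f) inDᴳ (λ i → star-nonRootDegreesIn {D} (f i) 1∈D)
      (λ i → subst D (cong (ℤ._+_ (signValue s)) (sym (star-rootDeg (f i)))) (values∈D i))

  hangStars-attains : ∀ G i → NonRootAttains (hangStars G s f) (signValue s ℤ.+ + f i)
  hangStars-attains G i = subst (NonRootAttains (hangStars G s f)) (cong (ℤ._+_ (signValue s)) (star-rootDeg (f i)))
    (attachAll-attains-root s G (star ∘ f) i)

  hangStars-attainsᴳ : ∀ {z} G → NonRootAttains G z → NonRootAttains (hangStars G s f) z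
  hangStars-attainsᴳ G = attachAll-attainsᴳ s G (star ∘ f)

positiveChild : ℤ → ℕ
positiveChild z = ℤ.∣ z ∣ ∸ 1

positiveChild-value : ∀ {z} → + 1 ℤ.< z → + 1 ℤ.+ + positiveChild z ≡ z
positiveChild-value {+ suc t} _ = refl
positiveChild-value {+ zero} (ℤ.+<+ ())

twos : ∀ k → Fin k → ℕ
twos _ _ = 2

module _ {nx} (x : Fin nx → ℤ) where

  -- The stars hung by positive edges give the values x j; the nx stars of value 1 hung by
  -- negative edges keep the degree of the root unchanged.
  withPositive : RootedTree → RootedTree
  withPositive G = hangStars (hangStars G plus (positiveChild ∘ x)) minus (twos nx)

  withPositive-rootDeg : ∀ G → rootDeg (withPositive G) ≡ rootDeg G
  withPositive-rootDeg G = begin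
    rootDeg (withPositive G)                                ≡⟨ hangStars-rootDeg minus (twos nx) _ ⟩
    rootDeg (hangStars G plus (positiveChild ∘ x)) ℤ.+ + nx ℤ.* signValue minus
      ≡⟨ cong (ℤ._+ + nx ℤ.* signValue minus) (hangStars-rootDeg plus (positiveChild ∘ x) G) ⟩
    rootDeg G ℤ.+ + nx ℤ.* + 1 ℤ.+ + nx ℤ.* ℤ.- + 1          ≡⟨ cancel (rootDeg G) (+ nx) ⟩
    rootDeg G                                               ∎
    where
    open ≡-Reasoning
    cancel : ∀ a K → a ℤ.+ K ℤ.* + 1 ℤ.+ K ℤ.* ℤ.- + 1 ≡ a
    cancel = solve-∀

  withPositive-height : ∀ G → HeightAtMost G 2 → HeightAtMost (withPositive G) 2
  withPositive-height G = hangStars-height minus (twos nx) _ ∘ hangStars-height plus (positiveChild ∘ x) G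

  withPositive-walks : ∀ G → HeightAtMost G 2 → WalksAtMost G 4 → WalksAtMost (withPositive G) 4
  withPositive-walks G heightG walksG =
    hangStars-walks minus (twos nx) _ (hangStars-height plus (positiveChild ∘ x) G heightG)
      (hangStars-walks plus (positiveChild ∘ x) G heightG walksG)

  module _ (x>1 : ∀ j → + 1 ℤ.< x j) where

    withPositive-nonRootDegreesIn : ∀ {D} G → NonRootDegreesIn G D → D (+ 1) → (∀ j → D (x j)) →
                                    NonRootDegreesIn (withPositive G) D
    withPositive-nonRootDegreesIn {D} G inDᴳ 1∈D x∈D =
      hangStars-nonRootDegreesIn minus (twos nx) {D} _
        (hangStars-nonRootDegreesIn plus (positiveChild ∘ x) {D} G inDᴳ 1∈D
          (λ j → subst D (sym (positiveChild-value (x>1 j))) (x∈D j)))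
        1∈D (λ _ → 1∈D)

    withPositive-attains : ∀ G j → NonRootAttains (withPositive G) (x j)
    withPositive-attains G j = hangStars-attainsᴳ minus (twos nx) positive
      (subst (NonRootAttains positive) (positiveChild-value (x>1 j)) (hangStars-attains plus (positiveChild ∘ x) G j))
      where positive = hangStars G plus (positiveChild ∘ x)

clusterChild : ℕ → ∀ {p} → Fin (suc p) → ℕ
clusterChild c zero = suc c
clusterChild c (suc _) = 2

-- p + 1 stars hung by negative edges: one of value c, the others of value 1.
cluster : ℕ → ℕ → RootedTree → RootedTree
cluster c p G = hangStars G minus (clusterChild c {p})

module _ (c p : ℕ) where

  cluster-rootDeg : ∀ G → rootDeg (cluster c p G) ≡ rootDeg G ℤ.+ -[1+ p ]
  cluster-rootDeg G = trans (hangStars-rootDeg minus (clusterChild c {p}) G)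
    (cong (ℤ._+_ (rootDeg G)) (trans (ℤP.*-comm (+ suc p) -[1+ 0 ]) (ℤP.-1*i≡-i (+ suc p))))

  cluster-height : ∀ G → HeightAtMost G 2 → HeightAtMost (cluster c p G) 2
  cluster-height = hangStars-height minus (clusterChild c {p})

  cluster-walks : ∀ G → HeightAtMost G 2 → WalksAtMost G 4 → WalksAtMost (cluster c p G) 4
  cluster-walks = hangStars-walks minus (clusterChild c {p})

  cluster-nonRootDegreesIn : ∀ {D} G → NonRootDegreesIn G D → D (+ 1) → D (+ c) → NonRootDegreesIn (cluster c p G) D
  cluster-nonRootDegreesIn {D} G inDᴳ 1∈D c∈D = hangStars-nonRootDegreesIn minus (clusterChild c {p}) {D} G inDᴳ 1∈D
    λ { zero → c∈D ; (suc _) → 1∈D }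

  cluster-attains-c : ∀ G → NonRootAttains (cluster c p G) (+ c)
  cluster-attains-c G = hangStars-attains minus (clusterChild c {p}) G zero

  cluster-attains-1 : ∀ G → NonRootAttains (cluster c p G) (+ 1)
  cluster-attains-1 G = attachAll-attainsᶠ minus G (star ∘ clusterChild c {p}) zero (star-attains-1 c)

  cluster-attainsᴳ : ∀ {z} G → NonRootAttains G z → NonRootAttains (cluster c p G) z
  cluster-attainsᴳ = hangStars-attainsᴳ minus (clusterChild c {p})

negativeDepth : ℤ → ℕ
negativeDepth y = ℤ.∣ y ∣ ∸ 2

<-1⇒negativeDepth : ∀ {y} → y ℤ.< -[1+ 0 ] → y ≡ -[1+ suc (negativeDepth y) ]
<-1⇒negativeDepth { -[1+ suc _ ]} _ = refl
<-1⇒negativeDepth { -[1+ zero ]} (ℤ.-<- ())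

Attained : RootedTree → ℤ → Set
Attained t z = ∃ λ v → sdeg (graph t) v ≡ z

record Realization (D : ℤ → Set) (P : ℕ) : Set where
  field
    tree     : RootedTree
    walks    : WalksAtMost tree P
    realizes : Realizes (graph tree) D

Realization-cong : ∀ {D D′ P} → (∀ z → D z ⇔ D′ z) → Realization D P → Realization D′ P
Realization-cong D⇔D′ r = record
  { tree = tree
  ; walks = walks
  ; realizes = λ z → mk⇔ (Equivalence.to (realizes z) ∘ Equivalence.from (D⇔D′ z))
                         (Equivalence.to (D⇔D′ z) ∘ Equivalence.from (realizes z))
  }
  where open Realization r

walks⇒Diam : ∀ t {P} → WalksAtMost t P → DistanceAtLeast (graph t) P → Diam (graph t) P
walks⇒Diam t {P} walks (u , v , d , dist , P≤d) =
  (u , v , subst (Dist (graph t) u v) (≤-antisym (distance≤P dist) P≤d) dist) , λ u′ v′ e → distance≤P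
  where
  distance≤P : ∀ {u v e} → Dist (graph t) u v e → e ≤ P
  distance≤P {u} {v} (_ , shortest) with walks u v
  ... | l , l≤P , walk = ≤-trans (shortest l walk) l≤P

Realization⇒DiamSet : ∀ {m} (y : Fin m → ℤ) → Injective _≡_ _≡_ y → (∀ i → y i ℤ.< -[1+ 0 ]) → 1 ≤ m →
                      ∀ {D} → ¬ D -[1+ 0 ] → (∀ i → D (y i)) → Realization D (predicted m) → DiamSet D (predicted m)
Realization⇒DiamSet {m} y y-inj y<-1 1≤m {D} -1∉D y∈D r =
  (graph tree , isTree , realizes , walks⇒Diam tree walks (far (graph tree) isTree realizes)) ,
  λ T e isTreeT realizesT diam → Diam-≥ diam (far T isTreeT realizesT)
  where
  open Realization r
  isTree : IsTree (graph tree)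
  isTree = WalksAtMost⇒IsTree tree walks
  far : ∀ T → IsTree T → Realizes T D → DistanceAtLeast T (predicted m)
  far T isTree realizesT = lowerBound T isTree (λ w eq → -1∉D (Equivalence.from (realizesT _) (w , eq)))
    m y y-inj y<-1 (λ i → Equivalence.to (realizesT (y i)) (y∈D i)) 1≤m

module Constructions {nx} (x : Fin nx → ℤ) (x>1 : ∀ j → + 1 ℤ.< x j) (c : ℕ) where

  Target : ∀ {m} → (Fin m → ℤ) → ℤ → Set
  Target y z = DSet y x z ⊎ z ≡ + c

  module _ {m} (y : Fin m → ℤ) where

    realizes-intro : ∀ t → Target y (rootDeg t) → NonRootDegreesIn t (Target y) →
                     NonRootAttains t (+ 1) → (∀ i → y i ≡ rootDeg t ⊎ NonRootAttains t (y i)) →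
                     (∀ j → NonRootAttains t (x j)) → NonRootAttains t (+ c) → Realizes (graph t) (Target y)
    realizes-intro t root∈T nonRoot∈T attained-1 attained-y attained-x attained-c z =
      mk⇔ attained λ { (zero , refl) → root∈T ; (suc v , refl) → nonRoot∈T v }
      where
      nonRoot : ∀ {z} → NonRootAttains t z → Attained t z
      nonRoot (v , eq) = suc v , eq
      attained : Target y z → Attained t z
      attained (inj₁ (inj₁ refl)) = nonRoot attained-1
      attained (inj₁ (inj₂ (inj₁ (i , refl)))) with attained-y i
      ... | inj₁ at-root = zero , sym at-root
      ... | inj₂ at-nonRoot = nonRoot at-nonRoot
      attained (inj₁ (inj₂ (inj₂ (j , refl)))) = nonRoot (attained-x j)
      attained (inj₂ refl) = nonRoot attained-c

    1∈T : Target y (+ 1)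
    1∈T = inj₁ (inj₁ refl)

    y∈T : ∀ i → Target y (y i)
    y∈T i = inj₁ (inj₂ (inj₁ (i , refl)))

    x∈T : ∀ j → Target y (x j)
    x∈T j = inj₁ (inj₂ (inj₂ (j , refl)))

    c∈T : Target y (+ c)
    c∈T = inj₂ refl

  base : RootedTree
  base = withPositive x single

  base-rootDeg : rootDeg base ≡ + 0
  base-rootDeg = withPositive-rootDeg x single

  base-height : HeightAtMost base 2
  base-height = withPositive-height x single single-height

  base-walks : WalksAtMost base 4
  base-walks = withPositive-walks x single single-height single-walks

  base-nonRootDegreesIn : ∀ {m} (y : Fin m → ℤ) → NonRootDegreesIn base (Target y)
  base-nonRootDegreesIn y = withPositive-nonRootDegreesIn x x>1 {Target y} single (λ ()) (1∈T y) (x∈T y)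

  -- The subtree of the vertex of value y i, to be joined to its parent by a negative edge; only
  -- the first one carries the values x j and c.
  branch : ∀ {m} → (Fin m → ℤ) → Fin m → RootedTree
  branch y zero = cluster c (negativeDepth (y zero)) base
  branch y (suc i) = cluster 1 (negativeDepth (y (suc i))) single

  branch₀-attains-x : ∀ {m} (y : Fin (suc m) → ℤ) j → NonRootAttains (branch y zero) (x j)
  branch₀-attains-x y j = cluster-attainsᴳ c (negativeDepth (y zero)) base (withPositive-attains x x>1 single j)

  branch₀-attains-c : ∀ {m} (y : Fin (suc m) → ℤ) → NonRootAttains (branch y zero) (+ c)
  branch₀-attains-c y = cluster-attains-c c (negativeDepth (y zero)) base

  module _ {m} (y : Fin m → ℤ) (y<-1 : ∀ i → y i ℤ.< -[1+ 0 ]) where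

    private
      p : Fin m → ℕ
      p i = negativeDepth (y i)

    branch-rootDeg : ∀ i → rootDeg (branch y i) ≡ -[1+ negativeDepth (y i) ]
    branch-rootDeg zero =
      trans (cluster-rootDeg c (p zero) base) (trans (cong (ℤ._+ -[1+ p zero ]) base-rootDeg) (ℤP.+-identityˡ _))
    branch-rootDeg (suc i) = trans (cluster-rootDeg 1 (p (suc i)) single) (ℤP.+-identityˡ _)

    branch-hung : ∀ i → signValue minus ℤ.+ rootDeg (branch y i) ≡ y i
    branch-hung i = trans (cong (ℤ._+_ -[1+ 0 ]) (branch-rootDeg i)) (sym (<-1⇒negativeDepth (y<-1 i)))

    branch-height : ∀ i → HeightAtMost (branch y i) 2
    branch-height zero = cluster-height c (p zero) base base-height
    branch-height (suc i) = cluster-height 1 (p (suc i)) single single-height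

    branch-walks : ∀ i → WalksAtMost (branch y i) 4
    branch-walks zero = cluster-walks c (p zero) base base-height base-walks
    branch-walks (suc i) = cluster-walks 1 (p (suc i)) single single-height single-walks

    branch-nonRootDegreesIn : ∀ i → NonRootDegreesIn (branch y i) (Target y)
    branch-nonRootDegreesIn zero =
      cluster-nonRootDegreesIn c (p zero) {Target y} base (base-nonRootDegreesIn y) (1∈T y) (c∈T y)
    branch-nonRootDegreesIn (suc i) = cluster-nonRootDegreesIn 1 (p (suc i)) {Target y} single (λ ()) (1∈T y) (1∈T y)

    branch-attains-1 : ∀ i → NonRootAttains (branch y i) (+ 1)
    branch-attains-1 zero = cluster-attains-1 c (p zero) base
    branch-attains-1 (suc i) = cluster-attains-1 1 (p (suc i)) single

  realization₁ : (y : Fin 1 → ℤ) → (∀ i → y i ℤ.< -[1+ 0 ]) → Realization (Target y) 4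
  realization₁ y y<-1 = record
    { tree = T
    ; walks = cluster-walks c (suc p) base base-height base-walks
    ; realizes = realizes-intro y T (subst (Target y) (sym root) (y∈T y zero))
        (cluster-nonRootDegreesIn c (suc p) {Target y} base (base-nonRootDegreesIn y) (1∈T y) (c∈T y))
        (cluster-attains-1 c (suc p) base)
        (λ { zero → inj₁ (sym root) })
        (λ j → cluster-attainsᴳ c (suc p) base (withPositive-attains x x>1 single j))
        (cluster-attains-c c (suc p) base)
    }
    where
    p = negativeDepth (y zero)
    T = cluster c (suc p) base
    root : rootDeg T ≡ y zero
    root = trans (cluster-rootDeg c (suc p) base)
             (trans (cong (ℤ._+ -[1+ suc p ]) base-rootDeg) (sym (<-1⇒negativeDepth (y<-1 zero))))

  realization₂ : (y : Fin 2 → ℤ) → (∀ i → y i ℤ.< -[1+ 0 ]) → Realization (Target y) 5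
  realization₂ y y<-1 = record
    { tree = T
    ; walks = Attach.walks A B minus (branch-height y y<-1 zero) (branch-height y y<-1 (suc zero))
                (WalksAtMost-mono A (n≤1+n 4) (branch-walks y y<-1 zero))
                (WalksAtMost-mono B (n≤1+n 4) (branch-walks y y<-1 (suc zero))) ≤-refl
    ; realizes = realizes-intro y T (subst (Target y) (sym root) (y∈T y zero))
        (Attach.nonRootDegreesIn A B minus {Target y} (branch-nonRootDegreesIn y y<-1 zero)
          (branch-nonRootDegreesIn y y<-1 (suc zero))
          (subst (Target y) (sym (branch-hung y y<-1 (suc zero))) (y∈T y (suc zero))))
        (Attach.attainsᴳ A B minus (branch-attains-1 y y<-1 zero))
        (λ { zero → inj₁ (sym root)
           ; (suc zero) → inj₂ (subst (NonRootAttains T) (branch-hung y y<-1 (suc zero)) (Attach.attains-rootH A B minus)) })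
        (λ j → Attach.attainsᴳ A B minus (branch₀-attains-x y j))
        (Attach.attainsᴳ A B minus (branch₀-attains-c y))
    }
    where
    A = branch y zero
    B = branch y (suc zero)
    T = attach A minus B
    root : rootDeg T ≡ y zero
    root = trans (Attach.rootDeg-tree A B minus) (trans (ℤP.+-comm (rootDeg A) _) (branch-hung y y<-1 zero))

  realization₃₊ : ∀ {k} (y : Fin (3 + k) → ℤ) → (∀ i → y i ℤ.< -[1+ 0 ]) → Realization (Target y) 6
  realization₃₊ {k} y y<-1 = record
    { tree = T
    ; walks = attachAll-walks minus centre (branch y)
                (HeightAtMost-mono centre (s≤s z≤n) (star-height (suc M))) (branch-height y y<-1)
                (WalksAtMost-mono centre (m≤m+n 2 4) (star-walks (suc M)))
                (λ i → WalksAtMost-mono (branch y i) (m≤m+n 4 2) (branch-walks y y<-1 i)) ≤-refl ≤-refl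
    ; realizes = realizes-intro y T (subst (Target y) (sym root) (1∈T y))
        (attachAll-nonRootDegreesIn minus {Target y} centre (branch y) (star-nonRootDegreesIn {Target y} (suc M) (1∈T y))
          (branch-nonRootDegreesIn y y<-1) (λ i → subst (Target y) (sym (branch-hung y y<-1 i)) (y∈T y i)))
        (attachAll-attainsᴳ minus centre (branch y) (star-attains-1 M))
        (λ i → inj₂ (subst (NonRootAttains T) (branch-hung y y<-1 i) (attachAll-attains-root minus centre (branch y) i)))
        (λ j → attachAll-attainsᶠ minus centre (branch y) zero (branch₀-attains-x y j))
        (attachAll-attainsᶠ minus centre (branch y) zero (branch₀-attains-c y))
    }
    where
    M = 3 + k
    centre = star (suc M)
    T = attachAll centre minus (branch y)
    root : rootDeg T ≡ + 1
    root = begin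
      rootDeg T                                   ≡⟨ attachAll-rootDeg minus centre (branch y) ⟩
      rootDeg centre ℤ.+ + M ℤ.* signValue minus  ≡⟨ cong (ℤ._+ + M ℤ.* signValue minus) (star-rootDeg (suc M)) ⟩
      + 1 ℤ.+ + M ℤ.+ + M ℤ.* ℤ.- + 1             ≡⟨ cancel (+ M) ⟩
      + 1                                         ∎
      where
      open ≡-Reasoning
      cancel : ∀ K → + 1 ℤ.+ K ℤ.+ K ℤ.* ℤ.- + 1 ≡ + 1
      cancel = solve-∀

  realization : ∀ m (y : Fin m → ℤ) → (∀ i → y i ℤ.< -[1+ 0 ]) → 1 ≤ m → Realization (Target y) (predicted m)
  realization 1 y y<-1 _ = realization₁ y y<-1
  realization 2 y y<-1 _ = realization₂ y y<-1
  realization (suc (suc (suc k))) y y<-1 _ = realization₃₊ y y<-1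

-1∉DSet : ∀ {m n} {y : Fin m → ℤ} {x : Fin n → ℤ} → (∀ i → y i ℤ.< -[1+ 0 ]) → (∀ j → + 1 ℤ.< x j) →
          ¬ DSet y x -[1+ 0 ]
-1∉DSet y<-1 x>1 (inj₂ (inj₁ (i , yi≡-1))) = ℤP.<-irrefl yi≡-1 (y<-1 i)
-1∉DSet y<-1 x>1 (inj₂ (inj₂ (j , xj≡-1))) with subst (+ 1 ℤ.<_) xj≡-1 (x>1 j)
... | ()

mainTheorem5 : (m n : ℕ) → 1 ≤ m →
    (y : Fin m → ℤ) → Injective _≡_ _≡_ y → (∀ i → y i ℤ.< -[1+ 0 ]) →
    (x : Fin n → ℤ) → Injective _≡_ _≡_ x → (∀ j → + 1 ℤ.< x j) →
    DiamSet (DSet y x) (predicted m) × DiamSet (DSet y x ∪0) (predicted m)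
mainTheorem5 m n 1≤m y y-inj y<-1 x _ x>1 =
  Realization⇒DiamSet y y-inj y<-1 1≤m -1∉D y∈D (Realization-cong D∪1⇔D (realization 1)) ,
  Realization⇒DiamSet y y-inj y<-1 1≤m (λ { (inj₁ d) → -1∉D d ; (inj₂ ()) }) (inj₁ ∘ y∈D) (realization 0)
  where
  realization : ∀ c → Realization (λ z → DSet y x z ⊎ z ≡ + c) (predicted m)
  realization c = Constructions.realization x x>1 c m y y<-1 1≤m
  -1∉D = -1∉DSet y<-1 x>1
  D∪1⇔D : ∀ z → (DSet y x z ⊎ z ≡ + 1) ⇔ DSet y x z
  D∪1⇔D z = mk⇔ (λ { (inj₁ z∈D) → z∈D ; (inj₂ refl) → inj₁ refl }) inj₁
  y∈D : ∀ i → DSet y x (y i)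
  y∈D i = inj₂ (inj₁ (i , refl))
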